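{- Let $(G=(V,E),S,r)$ be a minimal $3$-regular instance of Steiner Rooted $k$-Orientation with $t$ terminals, and let $\vec G$ be a feasible orientation. Let $S'\subseteq S$ be nonempty and let $X\subseteq V$ be a tight $s$-cut in $\vec G$ for every $s\in S'$. Then there is no directed cycle $C$ of $\vec G$ with $V(C)\subseteq X$ such that every terminal $s$ for which $C$ is $s$-essential belongs to $S'$.
   Context: Graphs are finite, loopless, and may have parallel edges. An instance $(G,S,r)$: $G$ undirected, $r\in V$, $S\subseteq V\setminus\{r\}$, $|S|=t$. An orientation is feasible if for every $s\in S$ there are $k$ pairwise arc-disjoint directed $r$-$s$ paths. The instance is $3$-regular if $r$ and every terminal have degree exactly $k$ and all other vertices degree $3$; it is minimal if $G$ has a feasible orientation but for every edge $e$, $G-e$ has none. In $\vec G$, for $s\in S$, an $s$-cut is $U\subseteq V$ with $r\in U$, $s\notin U$, and it is tight if exactly $k$ arcs leave $U$. $U$ properly intersects a directed cycle $C$ if $V(C)\cap U\ne\emptyset$ and $V(C)\setminus U\ne\emptyset$; $C$ is $s$-essential if some tight $s$-cut properly intersects it. -}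

module Defs where

open import Data.Nat using (ℕ; zero; suc; _+_)
open import Data.Bool using (Bool; true; false; if_then_else_; _∨_)
open import Data.Fin using (Fin; _≟_)
open import Data.Fin.Subset using (Subset; _∈_; _∉_)
open import Data.Fin.Subset.Properties using (_∈?_)
open import Data.List using (List; []; _∷_; length; lookup; map; filter; allFin; removeAt; foldr)
open import Data.List.Relation.Unary.All using (All)
open import Data.List.Relation.Unary.Unique.Propositional using (Unique)
open import Data.List.Membership.Propositional using () renaming (_∈_ to _∈ₗ_)
open import Data.Product using (Σ; ∃; _×_; _,_; proj₁; proj₂; swap)
open import Relation.Binary.PropositionalEquality using (_≡_; _≢_)
open import Relation.Nullary using (¬_)
open import Relation.Nullary.Decidable using (⌊_⌋; _×-dec_; ¬?)
open import Data.Empty using (⊥)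

-- A multigraph on vertex set Fin n: a list of edges (parallel edges allowed,
-- each list position is a distinct edge).
Edges : ℕ → Set
Edges n = List (Fin n × Fin n)

Loopless : ∀ {n} → Edges n → Set
Loopless E = All (λ e → proj₁ e ≢ proj₂ e) E

Arc : ∀ {n} → Edges n → Set
Arc E = Fin (length E)

-- An orientation: true = edge (u,v) oriented u→v, false = v→u.
Orientation : ∀ {n} → Edges n → Set
Orientation E = Arc E → Bool

arcEnds : ∀ {n} (E : Edges n) → Orientation E → Arc E → Fin n × Fin n
arcEnds E o a = if o a then lookup E a else swap (lookup E a)

tl hd : ∀ {n} (E : Edges n) → Orientation E → Arc E → Fin n
tl E o a = proj₁ (arcEnds E o a)
hd E o a = proj₂ (arcEnds E o a)

deg : ∀ {n} → Edges n → Fin n → ℕ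
deg E v = foldr (λ e acc → (if ⌊ v ≟ proj₁ e ⌋ ∨ ⌊ v ≟ proj₂ e ⌋ then 1 else 0) + acc) 0 E

data Walk {n} (E : Edges n) (o : Orientation E) : Fin n → Fin n → List (Arc E) → Set where
  nil  : ∀ {x} → Walk E o x x []
  step : ∀ {x y a as} → tl E o a ≡ x → Walk E o (hd E o a) y as → Walk E o x y (a ∷ as)

walkVerts : ∀ {n} (E : Edges n) → Orientation E → Fin n → List (Arc E) → List (Fin n)
walkVerts E o x as = x ∷ map (hd E o) as

IsPath : ∀ {n} (E : Edges n) → Orientation E → Fin n → Fin n → List (Arc E) → Set
IsPath E o x y as = Walk E o x y as × Unique (walkVerts E o x as)

ArcDisjointPaths : ∀ {n} (E : Edges n) → Orientation E → ℕ → Fin n → Fin n → Set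
ArcDisjointPaths E o k r s =
  Σ (Fin k → List (Arc E)) λ P →
    (∀ i → IsPath E o r s (P i)) ×
    (∀ i j a → i ≢ j → a ∈ₗ P i → a ∈ₗ P j → ⊥)

Feasible : ∀ {n} (E : Edges n) → Orientation E → ℕ → Fin n → Subset n → Set
Feasible E o k r S = ∀ s → s ∈ S → ArcDisjointPaths E o k r s

HasFeasible : ∀ {n} → Edges n → ℕ → Fin n → Subset n → Set
HasFeasible E k r S = Σ (Orientation E) λ o → Feasible E o k r S

Minimal : ∀ {n} → Edges n → ℕ → Fin n → Subset n → Set
Minimal E k r S = HasFeasible E k r S × (∀ e → ¬ HasFeasible (removeAt E e) k r S)

ThreeRegular : ∀ {n} → Edges n → ℕ → Fin n → Subset n → Set
ThreeRegular E k r S =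
  deg E r ≡ k × (∀ s → s ∈ S → deg E s ≡ k) × (∀ v → v ≢ r → v ∉ S → deg E v ≡ 3)

outDeg : ∀ {n} (E : Edges n) → Orientation E → Subset n → ℕ
outDeg E o U = length (filter (λ a → (tl E o a ∈? U) ×-dec ¬? (hd E o a ∈? U)) (allFin (length E)))

SCut : ∀ {n} → Fin n → Fin n → Subset n → Set
SCut r s U = r ∈ U × s ∉ U

TightCut : ∀ {n} (E : Edges n) → Orientation E → ℕ → Fin n → Fin n → Subset n → Set
TightCut E o k r s U = SCut r s U × outDeg E o U ≡ k

-- Directed cycle: a nonempty closed walk x → x whose vertices (the tails) are distinct
record DirCycle {n} (E : Edges n) (o : Orientation E) : Set where
  field
    start  : Fin n
    arcs   : List (Arc E)
    nonemp : arcs ≢ []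
    closed : Walk E o start start arcs
    simple : Unique (map (tl E o) arcs)

cycleVerts : ∀ {n} {E : Edges n} {o : Orientation E} → DirCycle E o → List (Fin n)
cycleVerts {E = E} {o} C = map (tl E o) (DirCycle.arcs C)

ProperlyIntersects : ∀ {n} {E : Edges n} {o : Orientation E} → Subset n → DirCycle E o → Set
ProperlyIntersects U C =
  (∃ λ v → v ∈ₗ cycleVerts C × v ∈ U) × (∃ λ v → v ∈ₗ cycleVerts C × v ∉ U)

Essential : ∀ {n} (E : Edges n) (o : Orientation E) → ℕ → Fin n → Fin n → DirCycle E o → Set
Essential E o k r s C = ∃ λ U → TightCut E o k r s U × ProperlyIntersects U C

{-# OPTIONS --safe #-}
-- Every arc b of C leaves a set A_b ⊆ X with r ∈ A_b and δ⁺(A_b) = k.  Indeed, by minimality the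
-- orientation restricted to G − b is infeasible for some terminal s, so Menger's theorem (here via a
-- single augmenting-path step, starting from k − 1 of the k given paths) yields R ∋ r, R ∌ s with
-- δ⁺(R) ≤ k that b leaves.  R is a tight s-cut properly intersecting C, hence s ∈ S′ and s ∉ X, and
-- submodularity against R ∪ X makes R ∩ X tight as well.  Two such tight sets A, B inside X never
-- cross: A ∩ B and A ∪ B still separate r from a terminal of S′, so submodularity leaves no arc from
-- A ∖ B to B ∖ A.  But the closed walk C leaves A_b, so it also enters it through some arc b′, and b′
-- runs from A_{b′} ∖ A_b to A_b ∖ A_{b′}.
module Submission where

open import Defs
open import Data.Nat using (ℕ; zero; suc; _+_; _≤_; z≤n; s≤s)
open import Data.Nat.Properties
  using (+-assoc; +-comm; +-identityʳ; +-suc; +-commutativeSemigroup; +-cancelʳ-≤; +-mono-≤; +-monoʳ-≤; +-monoˡ-≤;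
         1+n≰n; m<m+n; m≤m+n; m≤n+m; ≤-antisym; ≤-refl; ≤-reflexive; ≤-trans; ≤ᵇ⇒≤; module ≤-Reasoning)
open import Data.Nat.Tactic.RingSolver using (solve-∀)
open import Algebra.Properties.CommutativeSemigroup +-commutativeSemigroup using (x∙yz≈y∙xz; xy∙z≈xz∙y; interchange)
open import Data.Bool using (Bool; true; false; _∧_; _∨_; not; if_then_else_)
open import Data.Bool.Properties using (∧-zeroʳ; ∧-identityʳ; ¬-not) renaming (_≟_ to _≟ᵇ_)
open import Data.Fin using (Fin; zero; suc; punchIn)
open import Data.Fin.Properties using (injective⇒≤; suc-injective; 0≢1+n; any?; punchIn-injective; punchInᵢ≢i) renaming (_≟_ to _≟ᶠ_)
open import Data.Fin.Subset using (Subset; _∈_; _∉_; _⊆_; Nonempty; ∣_∣)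
open import Data.Fin.Subset.Properties using (_∈?_)
open import Data.Vec using (_∷_; lookup; tabulate)
open import Data.Vec.Properties using ([]=⇒lookup; lookup⇒[]=; lookup∘tabulate)
open import Data.List using (List; []; _∷_; _++_; map; length; removeAt; filter)
import Data.List as List
open import Data.List.Properties using (map-cong; map-∘)
open import Data.List.Relation.Unary.All as All using (All; []; _∷_)
open import Data.List.Relation.Unary.All.Properties using (++⁺; ¬Any⇒All¬)
open import Data.List.Relation.Unary.Any using (here; there)
open import Data.List.Relation.Unary.AllPairs using ([]; _∷_)
open import Data.List.Relation.Unary.Unique.Propositional using (Unique)
import Data.List.Relation.Unary.Unique.Propositional.Properties as Unique
open import Data.List.Membership.Propositional using () renaming (_∈_ to _∈ₗ_; _∉_ to _∉ₗ_)
open import Data.List.Relation.Binary.Subset.Propositional using () renaming (_⊆_ to _⊆ₗ_)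
open import Data.List.Membership.Propositional.Properties using (∈-map⁺)
import Data.List.Membership.DecPropositional as DecMembership
open import Data.Product using (Σ; ∃; _×_; _,_; proj₁; proj₂)
import Data.Product as Product
open import Data.Sum using (_⊎_; inj₁; inj₂; [_,_]′)
open import Data.Empty using (⊥; ⊥-elim)
open import Function.Definitions using (Injective)
open import Relation.Nullary using (¬_; Dec; yes; no; does; ¬?; _×-dec_; _⊎-dec_)
open import Relation.Unary using (Decidable)
open import Relation.Binary.PropositionalEquality
  using (_≡_; _≢_; refl; sym; trans; cong; cong₂; subst; subst₂; module ≡-Reasoning)

true≢false : true ≢ false
true≢false ()

∧≡true⇒ : ∀ {a b} → a ∧ b ≡ true → a ≡ true × b ≡ true
∧≡true⇒ {true} {true} _ = refl , refl

not≡true⇒ : ∀ {a} → not a ≡ true → a ≡ false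
not≡true⇒ {false} _ = refl

∨≡true-introˡ : ∀ {a} b → a ≡ true → a ∨ b ≡ true
∨≡true-introˡ b refl = refl

∨≡true-introʳ : ∀ a {b} → b ≡ true → a ∨ b ≡ true
∨≡true-introʳ true  _ = refl
∨≡true-introʳ false p = p

∨≡true⇒ : ∀ {a b} → a ∨ b ≡ true → a ≡ true ⊎ b ≡ true
∨≡true⇒ {true}  _ = inj₁ refl
∨≡true⇒ {false} p = inj₂ p

infix 7 _≡ᵇ_

_≡ᵇ_ : ∀ {m} → Fin m → Fin m → Bool
zero  ≡ᵇ zero  = true
zero  ≡ᵇ suc _ = false
suc _ ≡ᵇ zero  = false
suc i ≡ᵇ suc j = i ≡ᵇ j

≡ᵇ-refl : ∀ {m} (i : Fin m) → i ≡ᵇ i ≡ true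
≡ᵇ-refl zero    = refl
≡ᵇ-refl (suc i) = ≡ᵇ-refl i

≡ᵇ⇒≡ : ∀ {m} {i j : Fin m} → i ≡ᵇ j ≡ true → i ≡ j
≡ᵇ⇒≡ {i = zero}  {zero}  _ = refl
≡ᵇ⇒≡ {i = suc i} {suc j} p = cong suc (≡ᵇ⇒≡ p)

≢⇒≡ᵇ-false : ∀ {m} {i j : Fin m} → i ≢ j → i ≡ᵇ j ≡ false
≢⇒≡ᵇ-false {i = i} {j} i≢j with i ≡ᵇ j in eq
... | true  = ⊥-elim (i≢j (≡ᵇ⇒≡ eq))
... | false = refl

iverson : Bool → ℕ
iverson true  = 1
iverson false = 0

count : ∀ {m} → (Fin m → Bool) → ℕ
count {zero}  p = 0
count {suc m} p = iverson (p zero) + count (λ i → p (suc i))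

count-cong : ∀ {m} {p q : Fin m → Bool} → (∀ i → p i ≡ q i) → count p ≡ count q
count-cong {zero}  h = refl
count-cong {suc m} h = cong₂ _+_ (cong iverson (h zero)) (count-cong (λ i → h (suc i)))

count≤ : ∀ {m} (p : Fin m → Bool) → count p ≤ m
count≤ {zero}  p = z≤n
count≤ {suc m} p = +-mono-≤ (iverson≤1 (p zero)) (count≤ (λ i → p (suc i)))
  where
    iverson≤1 : ∀ x → iverson x ≤ 1
    iverson≤1 true  = ≤-refl
    iverson≤1 false = z≤n

count-false : ∀ {m} {p : Fin m → Bool} → (∀ i → p i ≡ false) → count p ≡ 0
count-false {zero}  h = refl
count-false {suc m} h rewrite h zero = count-false (λ i → h (suc i))

count>0⇒∃ : ∀ {m} (p : Fin m → Bool) → 1 ≤ count p → ∃ λ i → p i ≡ true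
count>0⇒∃ p h with any? (λ i → p i ≟ᵇ true)
... | yes found = found
... | no  none  = ⊥-elim (1+n≰n (subst (1 ≤_) (count-false (λ i → ¬-not (λ pi → none (i , pi)))) h))

_-ᶠ_ : ∀ {m} → (Fin m → Bool) → Fin m → Fin m → Bool
(p -ᶠ a) i = p i ∧ not (i ≡ᵇ a)

count-remove : ∀ {m} (p : Fin m → Bool) (a : Fin m) → count p ≡ iverson (p a) + count (p -ᶠ a)
count-remove {suc m} p zero = cong (iverson (p zero) +_) (sym (cong₂ _+_
  (cong iverson (∧-zeroʳ (p zero)))
  (count-cong (λ i → ∧-identityʳ (p (suc i))))))
count-remove {suc m} p (suc a) = begin
  iverson (p zero) + count (λ i → p (suc i))
    ≡⟨ cong (iverson (p zero) +_) (count-remove (λ i → p (suc i)) a) ⟩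
  iverson (p zero) + (iverson (p (suc a)) + count ((λ i → p (suc i)) -ᶠ a))
    ≡⟨ x∙yz≈y∙xz (iverson (p zero)) (iverson (p (suc a))) (count ((λ i → p (suc i)) -ᶠ a)) ⟩
  iverson (p (suc a)) + (iverson (p zero) + count ((λ i → p (suc i)) -ᶠ a))
    ≡⟨ cong (λ z → iverson (p (suc a)) + (iverson z + count ((λ i → p (suc i)) -ᶠ a))) (sym (∧-identityʳ (p zero))) ⟩
  iverson (p (suc a)) + count (p -ᶠ suc a) ∎
  where open ≡-Reasoning

witness⇒count>0 : ∀ {m} (p : Fin m → Bool) a → p a ≡ true → 1 ≤ count p
witness⇒count>0 p a pa = subst (1 ≤_) (sym (count-remove p a)) (subst (λ z → 1 ≤ iverson z + count (p -ᶠ a)) (sym pa) (s≤s z≤n))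

≤count-injective : ∀ {k m} (p : Fin m → Bool) (g : Fin k → Fin m) →
  Injective _≡_ _≡_ g → (∀ i → p (g i) ≡ true) → k ≤ count p
≤count-injective {zero}  p g g-inj pg = z≤n
≤count-injective {suc k} p g g-inj pg = begin
  suc k                                        ≤⟨ s≤s (≤count-injective (p -ᶠ g zero) (λ i → g (suc i)) (λ e → suc-injective (g-inj e)) rest) ⟩
  suc (count (p -ᶠ g zero))                    ≡⟨ cong (λ z → iverson z + count (p -ᶠ g zero)) (sym (pg zero)) ⟩
  iverson (p (g zero)) + count (p -ᶠ g zero)   ≡⟨ sym (count-remove p (g zero)) ⟩
  count p                                      ∎
  where
    open ≤-Reasoning
    rest : ∀ i → (p -ᶠ g zero) (g (suc i)) ≡ true
    rest i = cong₂ (λ u w → u ∧ not w) (pg (suc i)) (≢⇒≡ᵇ-false (λ e → 0≢1+n (sym (g-inj e))))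

enumerate : ∀ {m} (p : Fin m → Bool) →
  Σ (Fin (count p) → Fin m) λ g → (∀ i → p (g i) ≡ true) × Injective _≡_ _≡_ g
enumerate {zero}  p = (λ ()) , (λ ()) , (λ {})
enumerate {suc m} p with p zero in p0 | enumerate (λ i → p (suc i))
... | true  | g , pg , g-inj = g′ , pg′ , g′-inj
  where
    g′ : Fin (suc (count (λ i → p (suc i)))) → Fin (suc m)
    g′ zero    = zero
    g′ (suc i) = suc (g i)
    pg′ : ∀ i → p (g′ i) ≡ true
    pg′ zero    = p0
    pg′ (suc i) = pg i
    g′-inj : Injective _≡_ _≡_ g′
    g′-inj {zero}  {zero}  _ = refl
    g′-inj {suc i} {suc j} e = cong suc (g-inj (suc-injective e))
... | false | g , pg , g-inj = (λ i → suc (g i)) , pg , (λ e → g-inj (suc-injective e))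

count≤-injective : ∀ {m j} (p : Fin m → Bool) (f : ∀ i → p i ≡ true → Fin j) →
  (∀ a b pa pb → f a pa ≡ f b pb → a ≡ b) → count p ≤ j
count≤-injective p f f-inj with enumerate p
... | g , pg , g-inj = injective⇒≤ {f = λ i → f (g i) (pg i)} (λ e → g-inj (f-inj _ _ _ _ e))

count-pointwise-≤ : ∀ {m} (p q p′ q′ c : Fin m → Bool) →
  (∀ i → iverson (p′ i) + iverson (q′ i) + iverson (c i) ≤ iverson (p i) + iverson (q i)) →
  count p′ + count q′ + count c ≤ count p + count q
count-pointwise-≤ {zero}  p q p′ q′ c h = z≤n
count-pointwise-≤ {suc m} p q p′ q′ c h = subst₂ _≤_
  (rearrange (iverson (p′ zero)) (iverson (q′ zero)) (iverson (c zero)) _ _ _)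
  (interchange (iverson (p zero)) (iverson (q zero)) _ _)
  (+-mono-≤ (h zero) (count-pointwise-≤ _ _ _ _ _ (λ i → h (suc i))))
  where
    rearrange : ∀ a b c d e f → (a + b + c) + (d + e + f) ≡ (a + d) + (b + e) + (c + f)
    rearrange = solve-∀

count-insert : ∀ {m} (p : Fin m → Bool) (a : Fin m) → p a ≡ false →
  count (λ i → p i ∨ i ≡ᵇ a) ≡ suc (count p)
count-insert p a pa = begin
  count (λ i → p i ∨ i ≡ᵇ a)                                   ≡⟨ count-remove _ a ⟩
  iverson (p a ∨ a ≡ᵇ a) + count ((λ i → p i ∨ i ≡ᵇ a) -ᶠ a)   ≡⟨ cong₂ _+_ (cong iverson (∨≡true-introʳ (p a) (≡ᵇ-refl a))) (count-cong (λ i → ∨∧not (p i) (i ≡ᵇ a))) ⟩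
  suc (count (p -ᶠ a))                                          ≡⟨ cong (λ z → suc (iverson z + count (p -ᶠ a))) (sym pa) ⟩
  suc (iverson (p a) + count (p -ᶠ a))                          ≡⟨ cong suc (sym (count-remove p a)) ⟩
  suc (count p)                                                 ∎
  where
    open ≡-Reasoning
    ∨∧not : ∀ x y → (x ∨ y) ∧ not y ≡ x ∧ not y
    ∨∧not x     true  = trans (∧-zeroʳ _) (sym (∧-zeroʳ x))
    ∨∧not true  false = refl
    ∨∧not false false = refl

δ : ∀ {m} → Fin m → Fin m → ℕ
δ i j = iverson (i ≡ᵇ j)

δ-refl : ∀ {m} (i : Fin m) → δ i i ≡ 1
δ-refl i = cong iverson (≡ᵇ-refl i)

δ-≢ : ∀ {m} {i j : Fin m} → i ≢ j → δ i j ≡ 0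
δ-≢ i≢j = cong iverson (≢⇒≡ᵇ-false i≢j)

_∈ₗ?_ : ∀ {m} (x : Fin m) xs → Dec (x ∈ₗ xs)
_∈ₗ?_ = DecMembership._∈?_ _≟ᶠ_

PairwiseDisjoint : ∀ {A : Set} {k} → (Fin k → List A) → Set
PairwiseDisjoint {k = k} P = ∀ (i j : Fin k) a → i ≢ j → a ∈ₗ P i → a ∈ₗ P j → ⊥

module Digraph {n} (E : Edges n) (o : Orientation E) where

  tail head : Arc E → Fin n
  tail = tl E o
  head = hd E o

  leaves : (Fin n → Bool) → Arc E → Bool
  leaves R b = R (tail b) ∧ not (R (head b))

  δ⁺ : (Fin n → Bool) → ℕ
  δ⁺ R = count (leaves R)

  δ⁺-cong : ∀ {A B : Fin n → Bool} → (∀ x → A x ≡ B x) → δ⁺ A ≡ δ⁺ B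
  δ⁺-cong A≗B = count-cong (λ b → cong₂ (λ p q → p ∧ not q) (A≗B (tail b)) (A≗B (head b)))

  leaves-intro : ∀ {R b} → R (tail b) ≡ true → R (head b) ≡ false → leaves R b ≡ true
  leaves-intro p q rewrite p | q = refl

  leaves-elim : ∀ {R b} → leaves R b ≡ true → R (tail b) ≡ true × R (head b) ≡ false
  leaves-elim l = proj₁ (∧≡true⇒ l) , not≡true⇒ (proj₂ (∧≡true⇒ l))

  walk-exit : ∀ {R x y as} → Walk E o x y as → R x ≡ true → R y ≡ false →
    ∃ λ b → b ∈ₗ as × leaves R b ≡ true
  walk-exit nil Rx Ry = ⊥-elim (true≢false (trans (sym Rx) Ry))
  walk-exit {R} (step {a = a} p rest) Rx Ry with R (head a) in Ra
  ... | false = a , here refl , leaves-intro {R} (trans (cong R p) Rx) Ra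
  ... | true  with walk-exit rest Ra Ry
  ...   | b , b∈ , l = b , there b∈ , l

  arcDisjointPaths⇒≤δ⁺ : ∀ {R k r s} → ArcDisjointPaths E o k r s → R r ≡ true → R s ≡ false → k ≤ δ⁺ R
  arcDisjointPaths⇒≤δ⁺ {R} (P , paths , disjoint) Rr Rs =
    ≤count-injective (leaves R) exit exit-injective (λ i → proj₂ (proj₂ (exits i)))
    where
      exits : ∀ i → ∃ λ b → b ∈ₗ P i × leaves R b ≡ true
      exits i = walk-exit (proj₁ (paths i)) Rr Rs
      exit = λ i → proj₁ (exits i)
      exit-injective : Injective _≡_ _≡_ exit
      exit-injective {i} {j} eq with i ≟ᶠ j
      ... | yes i≡j = i≡j
      ... | no  i≢j = ⊥-elim (disjoint i j (exit i) i≢j (proj₁ (proj₂ (exits i)))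
                               (subst (_∈ₗ P j) (sym eq) (proj₁ (proj₂ (exits j)))))

  NoEntry : (Fin n → Bool) → List (Arc E) → Set
  NoEntry R as = ∀ b → b ∈ₗ as → R (head b) ≡ true → R (tail b) ≡ true

  noEntry-stays-outside : ∀ {R x y as} → Walk E o x y as → R x ≡ false → NoEntry R as →
    R y ≡ false × (∀ b → b ∈ₗ as → R (tail b) ≡ false)
  noEntry-stays-outside nil Rx _ = Rx , (λ _ ())
  noEntry-stays-outside {R} (step {a = a} p rest) Rx noEntry =
    proj₁ outside , λ { b (here refl) → Ra ; b (there b∈) → proj₂ outside b b∈ }
    where
      Ra : R (tail a) ≡ false
      Ra = trans (cong R p) Rx
      outside = noEntry-stays-outside {R} rest
        (¬-not (λ Ha → true≢false (trans (sym (noEntry a (here refl) Ha)) Ra)))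
        (λ b b∈ → noEntry b (there b∈))

  noEntry-leaves-once : ∀ {R x y as} → Walk E o x y as → NoEntry R as →
    ∀ a b → a ∈ₗ as → b ∈ₗ as → leaves R a ≡ true → leaves R b ≡ true → a ≡ b
  noEntry-leaves-once (step p rest) noEntry a b (here refl) (here refl) la lb = refl
  noEntry-leaves-once {R} (step p rest) noEntry a b (here refl) (there b∈) la lb =
    ⊥-elim (true≢false (trans (sym (proj₁ (leaves-elim {R} lb)))
      (proj₂ (noEntry-stays-outside {R} rest (proj₂ (leaves-elim {R} la)) (λ c c∈ → noEntry c (there c∈))) b b∈)))
  noEntry-leaves-once {R} (step p rest) noEntry a b (there a∈) (here refl) la lb =
    sym (noEntry-leaves-once {R} (step p rest) noEntry b a (here refl) (there a∈) lb la)
  noEntry-leaves-once {R} (step p rest) noEntry a b (there a∈) (there b∈) la lb =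
    noEntry-leaves-once {R} rest (λ c c∈ → noEntry c (there c∈)) a b a∈ b∈ la lb

  noEntry-leaves⇒end-outside : ∀ {R x y as b} → Walk E o x y as → NoEntry R as → b ∈ₗ as →
    leaves R b ≡ true → R y ≡ false
  noEntry-leaves⇒end-outside {R} (step p rest) noEntry (here refl) lb =
    proj₁ (noEntry-stays-outside {R} rest (proj₂ (leaves-elim {R} lb)) (λ c c∈ → noEntry c (there c∈)))
  noEntry-leaves⇒end-outside {R} (step p rest) noEntry (there b∈) lb =
    noEntry-leaves⇒end-outside {R} rest (λ c c∈ → noEntry c (there c∈)) b∈ lb

  closedWalk-noEntry⇒¬leaves : ∀ {R x as b} → Walk E o x x as → NoEntry R as → b ∈ₗ as → leaves R b ≢ true
  closedWalk-noEntry⇒¬leaves {R} w noEntry b∈ lb = true≢false (trans (sym (proj₁ (leaves-elim {R} lb)))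
    (proj₂ (noEntry-stays-outside {R} w (noEntry-leaves⇒end-outside {R} w noEntry b∈ lb) noEntry) _ b∈))

  crossing : (Fin n → Bool) → (Fin n → Bool) → Arc E → Bool
  crossing A B b = A (tail b) ∧ not (B (tail b)) ∧ B (head b) ∧ not (A (head b))

  δ⁺-submodular : ∀ A B →
    δ⁺ (λ x → A x ∧ B x) + δ⁺ (λ x → A x ∨ B x) + count (crossing A B) ≤ δ⁺ A + δ⁺ B
  δ⁺-submodular A B = count-pointwise-≤ _ _ _ _ _ (λ b → at-arc (A (tail b)) (A (head b)) (B (tail b)) (B (head b)))
    where
      at-arc : ∀ a a′ b b′ →
        iverson ((a ∧ b) ∧ not (a′ ∧ b′)) + iverson ((a ∨ b) ∧ not (a′ ∨ b′)) + iverson (a ∧ not b ∧ b′ ∧ not a′)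
          ≤ iverson (a ∧ not a′) + iverson (b ∧ not b′)
      at-arc true  true  true  true  = ≤ᵇ⇒≤ _ _ _
      at-arc true  true  true  false = ≤ᵇ⇒≤ _ _ _
      at-arc true  true  false true  = ≤ᵇ⇒≤ _ _ _
      at-arc true  true  false false = ≤ᵇ⇒≤ _ _ _
      at-arc true  false true  true  = ≤ᵇ⇒≤ _ _ _
      at-arc true  false true  false = ≤ᵇ⇒≤ _ _ _
      at-arc true  false false true  = ≤ᵇ⇒≤ _ _ _
      at-arc true  false false false = ≤ᵇ⇒≤ _ _ _
      at-arc false true  true  true  = ≤ᵇ⇒≤ _ _ _
      at-arc false true  true  false = ≤ᵇ⇒≤ _ _ _
      at-arc false true  false true  = ≤ᵇ⇒≤ _ _ _
      at-arc false true  false false = ≤ᵇ⇒≤ _ _ _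
      at-arc false false true  true  = ≤ᵇ⇒≤ _ _ _
      at-arc false false true  false = ≤ᵇ⇒≤ _ _ _
      at-arc false false false true  = ≤ᵇ⇒≤ _ _ _
      at-arc false false false false = ≤ᵇ⇒≤ _ _ _

  δ⁺-∧-≤ : ∀ {k} A B → δ⁺ A ≤ k → δ⁺ B ≤ k → k ≤ δ⁺ (λ x → A x ∨ B x) → δ⁺ (λ x → A x ∧ B x) ≤ k
  δ⁺-∧-≤ {k} A B A≤k B≤k k≤A∨B = +-cancelʳ-≤ k _ _ (begin
    δ⁺ (λ x → A x ∧ B x) + k                                                   ≤⟨ +-monoʳ-≤ (δ⁺ (λ x → A x ∧ B x)) k≤A∨B ⟩
    δ⁺ (λ x → A x ∧ B x) + δ⁺ (λ x → A x ∨ B x)                                ≤⟨ m≤m+n _ _ ⟩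
    δ⁺ (λ x → A x ∧ B x) + δ⁺ (λ x → A x ∨ B x) + count (crossing A B)         ≤⟨ δ⁺-submodular A B ⟩
    δ⁺ A + δ⁺ B                                                                ≤⟨ +-mono-≤ A≤k B≤k ⟩
    k + k                                                                      ∎)
    where open ≤-Reasoning

  δ⁺-uncrossed : ∀ {k} A B → δ⁺ A ≤ k → δ⁺ B ≤ k →
    k ≤ δ⁺ (λ x → A x ∧ B x) → k ≤ δ⁺ (λ x → A x ∨ B x) → ∀ b → crossing A B b ≢ true
  δ⁺-uncrossed {k} A B A≤k B≤k k≤A∧B k≤A∨B b cross = 1+n≰n (begin-strict
    k + k                                                                      ≤⟨ +-mono-≤ k≤A∧B k≤A∨B ⟩
    δ⁺ (λ x → A x ∧ B x) + δ⁺ (λ x → A x ∨ B x)                                <⟨ m<m+n _ (witness⇒count>0 (crossing A B) b cross) ⟩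
    δ⁺ (λ x → A x ∧ B x) + δ⁺ (λ x → A x ∨ B x) + count (crossing A B)         ≤⟨ δ⁺-submodular A B ⟩
    δ⁺ A + δ⁺ B                                                                ≤⟨ +-mono-≤ A≤k B≤k ⟩
    k + k                                                                      ∎)
    where open ≤-Reasoning

  crossing-intro : ∀ {A B b} → leaves A b ≡ true → B (tail b) ≡ false → B (head b) ≡ true → crossing A B b ≡ true
  crossing-intro {A} {B} {b} lb Bt Bh rewrite proj₁ (leaves-elim {A} lb) | proj₂ (leaves-elim {A} lb) | Bt | Bh = refl

  walk-head∈ : ∀ {x y as b} → Walk E o x y as → b ∈ₗ as → head b ∈ₗ map tail as ⊎ head b ≡ y
  walk-head∈ (step p nil)            (here refl) = inj₂ refl
  walk-head∈ (step p (step q rest))  (here refl) = inj₁ (there (here (sym q)))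
  walk-head∈ (step p rest)           (there b∈)  with walk-head∈ rest b∈
  ... | inj₁ h∈ = inj₁ (there h∈)
  ... | inj₂ eq = inj₂ eq

  closedWalk-head∈ : ∀ {x as b} → Walk E o x x as → b ∈ₗ as → head b ∈ₗ map tail as
  closedWalk-head∈ w@(step p _) b∈ with walk-head∈ w b∈
  ... | inj₁ h∈   = h∈
  ... | inj₂ refl = here (sym p)

  path⇒unique-arcs : ∀ {x y as} → IsPath E o x y as → Unique as
  path⇒unique-arcs (nil , _) = []
  path⇒unique-arcs (step p rest , _ ∷ (head∉ ∷ unique)) =
    ¬Any⇒All¬ _ (λ a∈ → All.lookup head∉ (∈-map⁺ head a∈) refl) ∷ path⇒unique-arcs (rest , head∉ ∷ unique)

  path-suffix : ∀ {x z y bs} → IsPath E o z y bs → x ∈ₗ walkVerts E o z bs →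
    Σ (List (Arc E)) λ cs → IsPath E o x y cs × cs ⊆ₗ bs
  path-suffix {bs = bs} path (here refl) = bs , path , λ b∈ → b∈
  path-suffix (step p rest , _ ∷ unique) (there x∈) with path-suffix (rest , unique) x∈
  ... | cs , path , cs⊆ = cs , path , λ b∈ → there (cs⊆ b∈)

  walk⇒path : ∀ {x y as} → Walk E o x y as → Σ (List (Arc E)) λ bs → IsPath E o x y bs × bs ⊆ₗ as
  walk⇒path nil = [] , (nil , [] ∷ []) , λ ()
  walk⇒path {x} (step {a = a} p rest) with walk⇒path rest
  ... | bs , path , bs⊆ with x ∈ₗ? walkVerts E o (head a) bs
  ...   | yes x∈ = let cs , path′ , cs⊆ = path-suffix path x∈ in cs , path′ , λ b∈ → there (bs⊆ (cs⊆ b∈))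
  ...   | no  x∉ = a ∷ bs , (step p (proj₁ path) , ¬Any⇒All¬ _ x∉ ∷ proj₂ path) ,
                   λ { (here refl) → here refl ; (there b∈) → there (bs⊆ b∈) }

  data ResidualWalk (F : Arc E → Bool) (e : Arc E) : Fin n → Fin n → List (Arc E) → Set where
    []  : ∀ {x} → ResidualWalk F e x x []
    fwd : ∀ {x y b bs} → tail b ≡ x → F b ≡ false → b ≢ e →
          ResidualWalk F e (head b) y bs → ResidualWalk F e x y (b ∷ bs)
    bwd : ∀ {x y b bs} → head b ≡ x → F b ≡ true →
          ResidualWalk F e (tail b) y bs → ResidualWalk F e x y (b ∷ bs)

  residualWalk-cong : ∀ {F F′ e x y bs} → (∀ {b} → b ∈ₗ bs → F b ≡ F′ b) →
    ResidualWalk F e x y bs → ResidualWalk F′ e x y bs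
  residualWalk-cong F≗F′ [] = []
  residualWalk-cong F≗F′ (fwd p Fb b≢e rest) =
    fwd p (trans (sym (F≗F′ (here refl))) Fb) b≢e (residualWalk-cong (λ b∈ → F≗F′ (there b∈)) rest)
  residualWalk-cong F≗F′ (bwd p Fb rest) =
    bwd p (trans (sym (F≗F′ (here refl))) Fb) (residualWalk-cong (λ b∈ → F≗F′ (there b∈)) rest)

  residualWalk-++ : ∀ {F e x y z ws vs} → ResidualWalk F e x y ws → ResidualWalk F e y z vs →
    ResidualWalk F e x z (ws ++ vs)
  residualWalk-++ [] q = q
  residualWalk-++ (fwd p Fb b≢e rest) q = fwd p Fb b≢e (residualWalk-++ rest q)
  residualWalk-++ (bwd p Fb rest) q = bwd p Fb (residualWalk-++ rest q)

  residualWalk-avoids : ∀ {F e x y ws} → ResidualWalk F e x y ws → F e ≡ false → e ∉ₗ ws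
  residualWalk-avoids (fwd p Fb b≢e rest) Fe (here refl) = b≢e refl
  residualWalk-avoids (fwd p Fb b≢e rest) Fe (there e∈) = residualWalk-avoids rest Fe e∈
  residualWalk-avoids (bwd p Fb rest) Fe (here refl) = true≢false (trans (sym Fb) Fe)
  residualWalk-avoids (bwd p Fb rest) Fe (there e∈) = residualWalk-avoids rest Fe e∈

  walk⇒residualWalk : ∀ {F e x y as} → Walk E o x y as → (∀ {b} → b ∈ₗ as → F b ≡ false × b ≢ e) →
    ResidualWalk F e x y as
  walk⇒residualWalk nil h = []
  walk⇒residualWalk (step p rest) h =
    fwd p (proj₁ (h (here refl))) (proj₂ (h (here refl))) (walk⇒residualWalk rest (λ b∈ → h (there b∈)))

  flowOut flowIn : (Arc E → Bool) → Fin n → ℕ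
  flowOut F v = count (λ b → F b ∧ v ≡ᵇ tail b)
  flowIn  F v = count (λ b → F b ∧ v ≡ᵇ head b)

  toggle : Arc E → (Arc E → Bool) → Arc E → Bool
  toggle a F b = if b ≡ᵇ a then not (F b) else F b

  toggle-self : ∀ a F → toggle a F a ≡ not (F a)
  toggle-self a F = cong (λ z → if z then not (F a) else F a) (≡ᵇ-refl a)

  toggle-other : ∀ {a b} F → b ≢ a → toggle a F b ≡ F b
  toggle-other {a} {b} F b≢a = cong (λ z → if z then not (F b) else F b) (≢⇒≡ᵇ-false b≢a)

  toggle-⊆ : ∀ {a b} F → F a ≡ true → toggle a F b ≡ true → F b ≡ true
  toggle-⊆ {a} {b} F Fa Fb′ with b ≡ᵇ a in b≡a
  ... | true  = subst (λ z → F z ≡ true) (sym (≡ᵇ⇒≡ b≡a)) Fa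
  ... | false = Fb′

  private
    toggle-∧-remove : ∀ a F (G : Arc E → Bool) b →
      ((λ x → toggle a F x ∧ G x) -ᶠ a) b ≡ ((λ x → F x ∧ G x) -ᶠ a) b
    toggle-∧-remove a F G b with b ≡ᵇ a
    ... | true  = trans (∧-zeroʳ _) (sym (∧-zeroʳ _))
    ... | false = refl

  count-toggle-∈ : ∀ a F (G : Arc E → Bool) → F a ≡ true →
    count (λ x → toggle a F x ∧ G x) + iverson (G a) ≡ count (λ x → F x ∧ G x)
  count-toggle-∈ a F G Fa = begin
    count toggled + iverson (G a)                                  ≡⟨ cong (_+ iverson (G a)) (count-remove toggled a) ⟩
    iverson (toggle a F a ∧ G a) + count (toggled -ᶠ a) + iverson (G a)
      ≡⟨ cong₂ (λ u w → iverson (u ∧ G a) + w + iverson (G a)) (trans (toggle-self a F) (cong not Fa)) (count-cong (toggle-∧-remove a F G)) ⟩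
    count (original -ᶠ a) + iverson (G a)                          ≡⟨ +-comm _ (iverson (G a)) ⟩
    iverson (G a) + count (original -ᶠ a)                          ≡⟨ cong (λ u → iverson (u ∧ G a) + count (original -ᶠ a)) (sym Fa) ⟩
    iverson (F a ∧ G a) + count (original -ᶠ a)                    ≡⟨ sym (count-remove original a) ⟩
    count original                                                 ∎
    where
      open ≡-Reasoning
      toggled original : Arc E → Bool
      toggled x = toggle a F x ∧ G x
      original x = F x ∧ G x

  count-toggle-∉ : ∀ a F (G : Arc E → Bool) → F a ≡ false →
    count (λ x → toggle a F x ∧ G x) ≡ count (λ x → F x ∧ G x) + iverson (G a)
  count-toggle-∉ a F G Fa = begin
    count toggled                                                  ≡⟨ count-remove toggled a ⟩
    iverson (toggle a F a ∧ G a) + count (toggled -ᶠ a)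
      ≡⟨ cong₂ (λ u w → iverson (u ∧ G a) + w) (trans (toggle-self a F) (cong not Fa)) (count-cong (toggle-∧-remove a F G)) ⟩
    iverson (G a) + count (original -ᶠ a)                          ≡⟨ +-comm (iverson (G a)) _ ⟩
    count (original -ᶠ a) + iverson (G a)                          ≡⟨ cong (λ u → iverson (u ∧ G a) + count (original -ᶠ a) + iverson (G a)) (sym Fa) ⟩
    iverson (F a ∧ G a) + count (original -ᶠ a) + iverson (G a)    ≡⟨ cong (_+ iverson (G a)) (sym (count-remove original a)) ⟩
    count original + iverson (G a)                                 ∎
    where
      open ≡-Reasoning
      toggled original : Arc E → Bool
      toggled x = toggle a F x ∧ G x
      original x = F x ∧ G x

  count-toggle-true : ∀ a F → F a ≡ true → suc (count (toggle a F)) ≡ count F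
  count-toggle-true a F Fa = begin
    suc (count (toggle a F))                           ≡⟨ +-comm 1 _ ⟩
    count (toggle a F) + 1                             ≡⟨ cong (_+ 1) (count-cong (λ x → sym (∧-identityʳ (toggle a F x)))) ⟩
    count (λ x → toggle a F x ∧ true) + 1              ≡⟨ count-toggle-∈ a F (λ _ → true) Fa ⟩
    count (λ x → F x ∧ true)                           ≡⟨ count-cong (λ x → ∧-identityʳ (F x)) ⟩
    count F                                            ∎
    where open ≡-Reasoning

  -- Augmenting paths in G − e.  IsFlow⁻ c F x is the state of an augmentation whose walk has reached
  -- x so far; IsFlow⁺ c F x the state while an r–s walk starting at x is being peeled off F.
  module Flow (r s : Fin n) (e : Arc E) where

    atRoot : ℕ → Fin n → ℕ
    atRoot c v = if v ≡ᵇ r then c else 0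

    atRoot-suc : ∀ c v → atRoot (suc c) v ≡ atRoot c v + δ v r
    atRoot-suc c v with v ≡ᵇ r
    ... | true  = +-comm 1 c
    ... | false = refl

    IsFlow : ℕ → (Arc E → Bool) → Set
    IsFlow c F = ∀ v → v ≢ s → flowIn F v + atRoot c v ≤ flowOut F v

    IsFlow⁻ IsFlow⁺ : ℕ → (Arc E → Bool) → Fin n → Set
    IsFlow⁻ c F x = ∀ v → v ≢ s → flowIn F v + atRoot c v ≤ flowOut F v + δ v x
    IsFlow⁺ c F x = ∀ v → v ≢ s → flowIn F v + atRoot c v + δ v x ≤ flowOut F v

    isFlow⇒isFlow⁻ : ∀ {c F} → IsFlow c F → IsFlow⁻ (suc c) F r
    isFlow⇒isFlow⁻ {c} {F} flow v v≢s = begin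
      flowIn F v + atRoot (suc c) v          ≡⟨ cong (flowIn F v +_) (atRoot-suc c v) ⟩
      flowIn F v + (atRoot c v + δ v r)      ≡⟨ sym (+-assoc (flowIn F v) _ _) ⟩
      flowIn F v + atRoot c v + δ v r        ≤⟨ +-monoˡ-≤ (δ v r) (flow v v≢s) ⟩
      flowOut F v + δ v r                    ∎
      where open ≤-Reasoning

    isFlow⇒isFlow⁺ : ∀ {c F} → IsFlow (suc c) F → IsFlow⁺ c F r
    isFlow⇒isFlow⁺ {c} {F} flow v v≢s = begin
      flowIn F v + atRoot c v + δ v r        ≡⟨ +-assoc (flowIn F v) _ _ ⟩
      flowIn F v + (atRoot c v + δ v r)      ≡⟨ cong (flowIn F v +_) (sym (atRoot-suc c v)) ⟩
      flowIn F v + atRoot (suc c) v          ≤⟨ flow v v≢s ⟩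
      flowOut F v                            ∎
      where open ≤-Reasoning

    isFlow⁻-at-sink : ∀ {c F} → IsFlow⁻ c F s → IsFlow c F
    isFlow⁻-at-sink {c} {F} flow v v≢s =
      subst (flowIn F v + atRoot c v ≤_) (trans (cong (flowOut F v +_) (δ-≢ v≢s)) (+-identityʳ _)) (flow v v≢s)

    isFlow⁺-at-sink : ∀ {c F} → IsFlow⁺ c F s → IsFlow c F
    isFlow⁺-at-sink {c} {F} flow v v≢s =
      subst (_≤ flowOut F v) (trans (cong (flowIn F v + atRoot c v +_) (δ-≢ v≢s)) (+-identityʳ _)) (flow v v≢s)

    augment-fwd : ∀ {c F b x} → tail b ≡ x → F b ≡ false → IsFlow⁻ c F x → IsFlow⁻ c (toggle b F) (head b)
    augment-fwd {c} {F} {b} refl Fb flow v v≢s = begin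
      flowIn (toggle b F) v + atRoot c v           ≡⟨ cong (_+ atRoot c v) (count-toggle-∉ b F (λ z → v ≡ᵇ head z) Fb) ⟩
      flowIn F v + δ v (head b) + atRoot c v       ≡⟨ xy∙z≈xz∙y (flowIn F v) _ _ ⟩
      flowIn F v + atRoot c v + δ v (head b)       ≤⟨ +-monoˡ-≤ (δ v (head b)) (flow v v≢s) ⟩
      flowOut F v + δ v (tail b) + δ v (head b)    ≡⟨ cong (_+ δ v (head b)) (sym (count-toggle-∉ b F (λ z → v ≡ᵇ tail z) Fb)) ⟩
      flowOut (toggle b F) v + δ v (head b)        ∎
      where open ≤-Reasoning

    augment-bwd : ∀ {c F b x} → head b ≡ x → F b ≡ true → IsFlow⁻ c F x → IsFlow⁻ c (toggle b F) (tail b)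
    augment-bwd {c} {F} {b} refl Fb flow v v≢s = +-cancelʳ-≤ (δ v (head b)) _ _ (begin
      flowIn (toggle b F) v + atRoot c v + δ v (head b)     ≡⟨ xy∙z≈xz∙y (flowIn (toggle b F) v) _ _ ⟩
      flowIn (toggle b F) v + δ v (head b) + atRoot c v     ≡⟨ cong (_+ atRoot c v) (count-toggle-∈ b F (λ z → v ≡ᵇ head z) Fb) ⟩
      flowIn F v + atRoot c v                               ≤⟨ flow v v≢s ⟩
      flowOut F v + δ v (head b)                            ≡⟨ cong (_+ δ v (head b)) (sym (count-toggle-∈ b F (λ z → v ≡ᵇ tail z) Fb)) ⟩
      flowOut (toggle b F) v + δ v (tail b) + δ v (head b)  ∎)
      where open ≤-Reasoning

    Augmentation : ℕ → (Arc E → Bool) → Fin n → List (Arc E) → Set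
    Augmentation c F y ws = Σ (Arc E → Bool) λ F′ → IsFlow⁻ c F′ y ×
      (∀ {b} → b ∉ₗ ws → F′ b ≡ F b) × (∀ {b} → b ∈ₗ ws → F′ b ≡ not (F b))

    augmentation-∷ : ∀ {c F y b bs} → All (b ≢_) bs → Augmentation c (toggle b F) y bs → Augmentation c F y (b ∷ bs)
    augmentation-∷ {F = F} {b = b} b∉ (F′ , flow , same , flipped) = F′ , flow ,
      (λ b′∉ → trans (same (λ b′∈ → b′∉ (there b′∈))) (toggle-other F (λ b′≡b → b′∉ (here b′≡b)))) ,
      λ { (here refl) → trans (same (λ b∈ → All.lookup b∉ b∈ refl)) (toggle-self b F)
        ; (there b′∈) → trans (flipped b′∈) (cong not (toggle-other F (λ b′≡b → All.lookup b∉ b′∈ (sym b′≡b)))) }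

    augment : ∀ {c F x y ws} → ResidualWalk F e x y ws → Unique ws → IsFlow⁻ c F x → Augmentation c F y ws
    augment {F = F} [] _ flow = F , flow , (λ _ → refl) , λ ()
    augment {F = F} (fwd p Fb _ rest) (b∉ ∷ unique) flow = augmentation-∷ b∉
      (augment (residualWalk-cong (λ b′∈ → sym (toggle-other F (λ b′≡b → All.lookup b∉ b′∈ (sym b′≡b)))) rest)
               unique (augment-fwd p Fb flow))
    augment {F = F} (bwd p Fb rest) (b∉ ∷ unique) flow = augmentation-∷ b∉
      (augment (residualWalk-cong (λ b′∈ → sym (toggle-other F (λ b′≡b → All.lookup b∉ b′∈ (sym b′≡b)))) rest)
               unique (augment-bwd p Fb flow))

    isFlow-∅ : IsFlow 0 (λ _ → false)
    isFlow-∅ v _ = begin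
      flowIn (λ _ → false) v + atRoot 0 v   ≡⟨ cong₂ _+_ (count-false {p = λ (b : Arc E) → false} (λ _ → refl)) (atRoot-zero v) ⟩
      0                                     ≤⟨ z≤n ⟩
      flowOut (λ _ → false) v               ∎
      where
        open ≤-Reasoning
        atRoot-zero : ∀ v → atRoot 0 v ≡ 0
        atRoot-zero v with v ≡ᵇ r
        ... | true  = refl
        ... | false = refl

    pathsFlow : ∀ k (Q : Fin k → List (Arc E)) → (∀ i → IsPath E o r s (Q i)) →
      (∀ i {b} → b ∈ₗ Q i → b ≢ e) → PairwiseDisjoint Q →
      Σ (Arc E → Bool) λ F → IsFlow k F × (∀ b → F b ≡ true → ∃ λ i → b ∈ₗ Q i) ×
        (∀ i {b} → b ∈ₗ Q i → F b ≡ true) × F e ≡ false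
    pathsFlow zero Q _ _ _ = (λ _ → false) , isFlow-∅ , (λ _ ()) , (λ ()) , refl
    pathsFlow (suc k) Q paths avoid disjoint
      with pathsFlow k (λ i → Q (suc i)) (λ i → paths (suc i)) (λ i → avoid (suc i))
                       (λ i j a i≢j → disjoint (suc i) (suc j) a (λ eq → i≢j (suc-injective eq)))
    ... | F , flow , F⊆Q , Q⊆F , Fe = F′ , isFlow⁻-at-sink flow′ , F′⊆Q , Q⊆F′ , F′e
      where
        Q₀∩F=∅ : ∀ {b} → b ∈ₗ Q zero → F b ≡ false
        Q₀∩F=∅ {b} b∈ = ¬-not λ Fb → let i , b∈′ = F⊆Q b Fb in disjoint zero (suc i) b (λ ()) b∈ b∈′
        augmentation = augment (walk⇒residualWalk (proj₁ (paths zero)) (λ b∈ → Q₀∩F=∅ b∈ , avoid zero b∈))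
                               (path⇒unique-arcs (paths zero)) (isFlow⇒isFlow⁻ flow)
        F′ = proj₁ augmentation
        flow′ = proj₁ (proj₂ augmentation)
        same = proj₁ (proj₂ (proj₂ augmentation))
        flipped = proj₂ (proj₂ (proj₂ augmentation))
        F′⊆Q : ∀ b → F′ b ≡ true → ∃ λ i → b ∈ₗ Q i
        F′⊆Q b F′b with b ∈ₗ? Q zero
        ... | yes b∈ = zero , b∈
        ... | no  b∉ = let i , b∈ = F⊆Q b (trans (sym (same b∉)) F′b) in suc i , b∈
        Q⊆F′ : ∀ i {b} → b ∈ₗ Q i → F′ b ≡ true
        Q⊆F′ zero    b∈ = trans (flipped b∈) (cong not (Q₀∩F=∅ b∈))
        Q⊆F′ (suc i) b∈ = trans (same (λ b∈₀ → disjoint zero (suc i) _ (λ ()) b∈₀ b∈)) (Q⊆F i b∈)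
        F′e : F′ e ≡ false
        F′e = trans (same (λ e∈ → avoid zero e∈ refl)) Fe

    peel-step : ∀ {c F x} → x ≢ s → IsFlow⁺ c F x →
      ∃ λ a → F a ≡ true × tail a ≡ x × IsFlow⁺ c (toggle a F) (head a)
    peel-step {c} {F} {x} x≢s flow = a , Fa , ta , flow′
      where
        out>0 : 1 ≤ flowOut F x
        out>0 = ≤-trans (subst (1 ≤_) (cong (flowIn F x + atRoot c x +_) (sym (δ-refl x))) (m≤n+m 1 _)) (flow x x≢s)
        found = count>0⇒∃ (λ b → F b ∧ x ≡ᵇ tail b) out>0
        a = proj₁ found
        Fa : F a ≡ true
        Fa = proj₁ (∧≡true⇒ (proj₂ found))
        ta : tail a ≡ x
        ta = sym (≡ᵇ⇒≡ (proj₂ (∧≡true⇒ {F a} (proj₂ found))))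
        flow′ : IsFlow⁺ c (toggle a F) (head a)
        flow′ v v≢s = +-cancelʳ-≤ (δ v x) _ _ (begin
          flowIn (toggle a F) v + atRoot c v + δ v (head a) + δ v x
            ≡⟨ cong (_+ δ v x) (xy∙z≈xz∙y (flowIn (toggle a F) v) _ _) ⟩
          flowIn (toggle a F) v + δ v (head a) + atRoot c v + δ v x
            ≡⟨ cong (λ z → z + atRoot c v + δ v x) (count-toggle-∈ a F (λ z → v ≡ᵇ head z) Fa) ⟩
          flowIn F v + atRoot c v + δ v x                         ≤⟨ flow v v≢s ⟩
          flowOut F v                                             ≡⟨ sym (count-toggle-∈ a F (λ z → v ≡ᵇ tail z) Fa) ⟩
          flowOut (toggle a F) v + δ v (tail a)                   ≡⟨ cong (λ z → flowOut (toggle a F) v + δ v z) ta ⟩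
          flowOut (toggle a F) v + δ v x                          ∎)
          where open ≤-Reasoning

    Peeled : ℕ → (Arc E → Bool) → Fin n → Set
    Peeled c F x = Σ (List (Arc E)) λ ws → Σ (Arc E → Bool) λ F′ → Walk E o x s ws ×
      (∀ {b} → b ∈ₗ ws → F b ≡ true) × (∀ {b} → b ∈ₗ ws → F′ b ≡ false) ×
      (∀ b → F′ b ≡ true → F b ≡ true) × IsFlow c F′

    peel : ∀ {c} fuel F x → count F ≤ fuel → IsFlow⁺ c F x → Peeled c F x
    peel fuel F x bound flow with x ≟ᶠ s
    ... | yes refl = [] , F , nil , (λ ()) , (λ ()) , (λ _ Fb → Fb) , isFlow⁺-at-sink flow
    ... | no x≢s with peel-step x≢s flow
    ...   | a , Fa , refl , flow′ with fuel | subst (_≤ fuel) (sym (count-toggle-true a F Fa)) bound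
    ...     | suc fuel′ | s≤s bound′ with peel fuel′ (toggle a F) (head a) bound′ flow′
    ...       | ws , F′ , walk , ws⊆F , ws∩F′=∅ , F′⊆F , flow″ =
      a ∷ ws , F′ , step refl walk ,
      (λ { (here refl) → Fa ; (there b∈) → toggle-⊆ F Fa (ws⊆F b∈) }) ,
      (λ { (here refl) → a∉F′ ; (there b∈) → ws∩F′=∅ b∈ }) ,
      (λ b F′b → toggle-⊆ F Fa (F′⊆F b F′b)) , flow″
      where
        a∉F′ : F′ a ≡ false
        a∉F′ = ¬-not λ F′a → true≢false (trans (sym (F′⊆F a F′a)) (trans (toggle-self a F) (cong not Fa)))

    decompose : ∀ c F → IsFlow c F → Σ (Fin c → List (Arc E)) λ P →
      (∀ i → IsPath E o r s (P i)) × (∀ i {b} → b ∈ₗ P i → F b ≡ true) × PairwiseDisjoint P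
    decompose zero F _ = (λ ()) , (λ ()) , (λ ()) , (λ ())
    decompose (suc c) F flow with peel (count F) F r ≤-refl (isFlow⇒isFlow⁺ flow)
    ... | ws , F′ , walk , ws⊆F , ws∩F′=∅ , F′⊆F , flow′ with walk⇒path walk | decompose c F′ flow′
    ...   | cs , path , cs⊆ws | P , paths , P⊆F′ , disjoint = P′ , paths′ , P′⊆F , disjoint′
      where
        P′ : Fin (suc c) → List (Arc E)
        P′ zero    = cs
        P′ (suc i) = P i
        paths′ : ∀ i → IsPath E o r s (P′ i)
        paths′ zero    = path
        paths′ (suc i) = paths i
        P′⊆F : ∀ i {b} → b ∈ₗ P′ i → F b ≡ true
        P′⊆F zero    b∈ = ws⊆F (cs⊆ws b∈)
        P′⊆F (suc i) b∈ = F′⊆F _ (P⊆F′ i b∈)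
        disjoint′ : PairwiseDisjoint P′
        disjoint′ zero    zero    b i≢j _ _ = i≢j refl
        disjoint′ zero    (suc j) b _ b∈ b∈′ = true≢false (trans (sym (P⊆F′ j b∈′)) (ws∩F′=∅ (cs⊆ws b∈)))
        disjoint′ (suc i) zero    b _ b∈ b∈′ = true≢false (trans (sym (P⊆F′ i b∈)) (ws∩F′=∅ (cs⊆ws b∈′)))
        disjoint′ (suc i) (suc j) b i≢j b∈ b∈′ = disjoint i j b (λ eq → i≢j (cong suc eq)) b∈ b∈′

    ResidualExit : (Fin n → Bool) → (Arc E → Bool) → Arc E → Set
    ResidualExit R F b =
      (R (tail b) ≡ true × R (head b) ≡ false × F b ≡ false × b ≢ e) ⊎
      (R (head b) ≡ true × R (tail b) ≡ false × F b ≡ true)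

    residualExit? : ∀ R F → Decidable (ResidualExit R F)
    residualExit? R F b =
      (R (tail b) ≟ᵇ true ×-dec R (head b) ≟ᵇ false ×-dec F b ≟ᵇ false ×-dec ¬? (b ≟ᶠ e)) ⊎-dec
      (R (head b) ≟ᵇ true ×-dec R (tail b) ≟ᵇ false ×-dec F b ≟ᵇ true)

    Reachable : (Arc E → Bool) → (Fin n → Bool) → Set
    Reachable F R = ∀ v → R v ≡ true → Σ (List (Arc E)) λ ws →
      ResidualWalk F e r v ws × Unique ws × All (λ b → R (tail b) ≡ true × R (head b) ≡ true) ws

    reachable-root : ∀ {F} → Reachable F (_≡ᵇ r)
    reachable-root v v≡ᵇr with ≡ᵇ⇒≡ {i = v} v≡ᵇr
    ... | refl = [] , [] , [] , []

    reachable-insert : ∀ {F R u w b} → R u ≡ true → R w ≡ false → ResidualWalk F e u w (b ∷ []) →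
      (tail b ≡ u × head b ≡ w) ⊎ (head b ≡ u × tail b ≡ w) →
      Reachable F R → Reachable F (λ v → R v ∨ v ≡ᵇ w)
    reachable-insert {F} {R} {u} {w} {b} Ru Rw hop ends reach = reach′
      where
        R′ : Fin n → Bool
        R′ v = R v ∨ v ≡ᵇ w
        widen : ∀ {b′} → R (tail b′) ≡ true × R (head b′) ≡ true → R′ (tail b′) ≡ true × R′ (head b′) ≡ true
        widen (t , h) = ∨≡true-introˡ _ t , ∨≡true-introˡ _ h
        Ends = (tail b ≡ u × head b ≡ w) ⊎ (head b ≡ u × tail b ≡ w)
        b-outside : Ends → ¬ (R (tail b) ≡ true × R (head b) ≡ true)
        b-outside (inj₁ (_ , hw)) (_ , h) = true≢false (trans (sym h) (trans (cong R hw) Rw))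
        b-outside (inj₂ (_ , tw)) (t , _) = true≢false (trans (sym t) (trans (cong R tw) Rw))
        b∉ : ∀ {ws} → All (λ b′ → R (tail b′) ≡ true × R (head b′) ≡ true) ws → b ∉ₗ ws
        b∉ inside b∈ = b-outside ends (All.lookup inside b∈)
        R′u : R′ u ≡ true
        R′u = ∨≡true-introˡ _ Ru
        R′w : R′ w ≡ true
        R′w = ∨≡true-introʳ (R w) (≡ᵇ-refl w)
        b-inside : Ends → R′ (tail b) ≡ true × R′ (head b) ≡ true
        b-inside (inj₁ (tu , hw)) = subst (λ z → R′ z ≡ true) (sym tu) R′u , subst (λ z → R′ z ≡ true) (sym hw) R′w
        b-inside (inj₂ (hu , tw)) = subst (λ z → R′ z ≡ true) (sym tw) R′w , subst (λ z → R′ z ≡ true) (sym hu) R′u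
        reach′ : Reachable F R′
        reach′ v R′v with ∨≡true⇒ {R v} R′v
        ... | inj₁ Rv = let ws , walk , unique , inside = reach v Rv in ws , walk , unique , All.map widen inside
        ... | inj₂ v≡ᵇw with ≡ᵇ⇒≡ {i = v} v≡ᵇw
        ...   | refl = let ws , walk , unique , inside = reach u Ru in
          ws ++ b ∷ [] , residualWalk-++ walk hop ,
          Unique.++⁺ unique ([] ∷ []) (λ { (b∈ , here refl) → b∉ inside b∈ }) ,
          ++⁺ (All.map widen inside) (b-inside ends ∷ [])

    ResidualCut : (Arc E → Bool) → (Fin n → Bool) → Set
    ResidualCut F R = R r ≡ true × R s ≡ false ×
      (∀ b → R (tail b) ≡ true → R (head b) ≡ false → F b ≡ true ⊎ b ≡ e) ×
      (∀ b → R (head b) ≡ true → R (tail b) ≡ false → F b ≡ false)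

    AugmentingWalkOrCut : (Arc E → Bool) → Set
    AugmentingWalkOrCut F = (Σ (List (Arc E)) λ ws → ResidualWalk F e r s ws × Unique ws) ⊎ ∃ (ResidualCut F)

    closure : ∀ F fuel R → R r ≡ true → Reachable F R → n ≤ fuel + count R → AugmentingWalkOrCut F
    grow : ∀ F fuel R → R r ≡ true → Reachable F R → n ≤ fuel + count R →
      ∀ {u w b} → R u ≡ true → R w ≡ false → ResidualWalk F e u w (b ∷ []) →
      (tail b ≡ u × head b ≡ w) ⊎ (head b ≡ u × tail b ≡ w) → AugmentingWalkOrCut F

    closure F fuel R Rr reach bound with any? (residualExit? R F)
    ... | yes (b , inj₁ (t , h , Fb , b≢e)) = grow F fuel R Rr reach bound t h (fwd refl Fb b≢e []) (inj₁ (refl , refl))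
    ... | yes (b , inj₂ (h , t , Fb))       = grow F fuel R Rr reach bound h t (bwd refl Fb []) (inj₂ (refl , refl))
    ... | no none with R s in Rs
    ...   | true  = let ws , walk , unique , _ = reach s Rs in inj₁ (ws , walk , unique)
    ...   | false = inj₂ (R , Rr , Rs , leaving , entering)
      where
        leaving : ∀ b → R (tail b) ≡ true → R (head b) ≡ false → F b ≡ true ⊎ b ≡ e
        leaving b t h with F b in Fb | b ≟ᶠ e
        ... | true  | _       = inj₁ refl
        ... | false | yes b≡e = inj₂ b≡e
        ... | false | no  b≢e = ⊥-elim (none (b , inj₁ (t , h , Fb , b≢e)))
        entering : ∀ b → R (head b) ≡ true → R (tail b) ≡ false → F b ≡ false
        entering b h t = ¬-not λ Fb → none (b , inj₂ (h , t , Fb))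

    grow F zero R Rr reach bound {w = w} Ru Rw hop ends =
      ⊥-elim (1+n≰n (≤-trans (subst (_≤ n) (count-insert R w Rw) (count≤ _)) bound))
    grow F (suc fuel) R Rr reach bound {w = w} Ru Rw hop ends =
      closure F fuel (λ v → R v ∨ v ≡ᵇ w) (∨≡true-introˡ _ Rr) (reachable-insert Ru Rw hop ends reach)
        (subst (n ≤_) (sym (trans (cong (fuel +_) (count-insert R w Rw)) (+-suc fuel (count R)))) bound)

    AvoidingPaths : ℕ → Set
    AvoidingPaths k = Σ (Fin k → List (Arc E)) λ Q →
      (∀ i → IsPath E o r s (Q i)) × (∀ i {b} → b ∈ₗ Q i → b ≢ e) × PairwiseDisjoint Q

    dropPathThrough : ∀ {k} → ArcDisjointPaths E o (suc k) r s → AvoidingPaths k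
    dropPathThrough {k} (P , paths , disjoint) = Q , (λ j → paths (punchIn i₀ j)) , avoid , Q-disjoint
      where
        others-avoid : ∃ λ i₀ → ∀ j → e ∉ₗ P (punchIn i₀ j)
        others-avoid with any? (λ i → e ∈ₗ? P i)
        ... | yes (i , e∈) = i , λ j e∈′ → disjoint (punchIn i j) i e (punchInᵢ≢i i j) e∈′ e∈
        ... | no  none     = zero , λ j e∈ → none (punchIn zero j , e∈)
        i₀ = proj₁ others-avoid
        Q : Fin k → List (Arc E)
        Q j = P (punchIn i₀ j)
        avoid : ∀ j {b} → b ∈ₗ Q j → b ≢ e
        avoid j b∈ refl = proj₂ others-avoid j b∈
        Q-disjoint : PairwiseDisjoint Q
        Q-disjoint i j b i≢j = disjoint _ _ b (λ eq → i≢j (punchIn-injective i₀ i j eq))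

    reroute : ∀ {k F ws} → IsFlow k F → F e ≡ false → ResidualWalk F e r s ws → Unique ws → AvoidingPaths (suc k)
    reroute {k} {F} flow Fe walk unique = P , paths , avoid , disjoint
      where
        augmentation = augment walk unique (isFlow⇒isFlow⁻ flow)
        F′ = proj₁ augmentation
        F′e : F′ e ≡ false
        F′e = trans (proj₁ (proj₂ (proj₂ augmentation)) (residualWalk-avoids walk Fe)) Fe
        decomposition = decompose (suc k) F′ (isFlow⁻-at-sink (proj₁ (proj₂ augmentation)))
        P = proj₁ decomposition
        paths = proj₁ (proj₂ decomposition)
        disjoint = proj₂ (proj₂ (proj₂ decomposition))
        avoid : ∀ i {b} → b ∈ₗ P i → b ≢ e
        avoid i b∈ refl = true≢false (trans (sym (proj₁ (proj₂ (proj₂ decomposition)) i b∈)) F′e)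

    cut-bound : ∀ {k F R} → ArcDisjointPaths E o (suc k) r s → ((Q , _) : AvoidingPaths k) →
      (∀ b → F b ≡ true → ∃ λ i → b ∈ₗ Q i) → (∀ i {b} → b ∈ₗ Q i → F b ≡ true) → ResidualCut F R →
      leaves R e ≡ true × δ⁺ R ≤ suc k
    cut-bound {k} {F} {R} paths (Q , Qpaths , _) F⊆Q Q⊆F (Rr , Rs , leaving , entering) = e-leaves , bound
      where
        leaving-in-F : ∀ b → (leaves R -ᶠ e) b ≡ true → F b ≡ true
        leaving-in-F b lb with ∧≡true⇒ lb
        ... | l , b≢e with leaving b (proj₁ (leaves-elim {R} l)) (proj₂ (leaves-elim {R} l))
        ...   | inj₁ Fb   = Fb
        ...   | inj₂ refl = ⊥-elim (true≢false (trans (sym (≡ᵇ-refl e)) (not≡true⇒ b≢e)))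
        index : ∀ b → (leaves R -ᶠ e) b ≡ true → Fin k
        index b lb = proj₁ (F⊆Q b (leaving-in-F b lb))
        noEntry : ∀ i → NoEntry R (Q i)
        noEntry i c c∈ Rh = ¬-not λ Rt → true≢false (trans (sym (Q⊆F i c∈)) (entering c Rh Rt))
        index-injective : ∀ a b la lb → index a la ≡ index b lb → a ≡ b
        index-injective a b la lb eq =
          noEntry-leaves-once {R} (proj₁ (Qpaths i)) (noEntry i) a b a∈ b∈ (proj₁ (∧≡true⇒ la)) (proj₁ (∧≡true⇒ lb))
          where
            i = index a la
            a∈ = proj₂ (F⊆Q a (leaving-in-F a la))
            b∈ : b ∈ₗ Q i
            b∈ = subst (λ j → b ∈ₗ Q j) (sym eq) (proj₂ (F⊆Q b (leaving-in-F b lb)))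
        others≤k : count (leaves R -ᶠ e) ≤ k
        others≤k = count≤-injective _ index index-injective
        split : ∀ {x} → leaves R e ≡ x → δ⁺ R ≡ iverson x + count (leaves R -ᶠ e)
        split le = trans (count-remove (leaves R) e) (cong (λ z → iverson z + count (leaves R -ᶠ e)) le)
        e-leaves : leaves R e ≡ true
        e-leaves = ¬-not λ le → 1+n≰n (≤-trans (arcDisjointPaths⇒≤δ⁺ paths Rr Rs) (subst (_≤ k) (sym (split le)) others≤k))
        bound : δ⁺ R ≤ suc k
        bound = subst (_≤ suc k) (sym (split e-leaves)) (s≤s others≤k)

    avoid-or-cut : ∀ k → ArcDisjointPaths E o k r s →
      AvoidingPaths k ⊎ (Σ (Fin n → Bool) λ R → R r ≡ true × R s ≡ false × leaves R e ≡ true × δ⁺ R ≤ k)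
    avoid-or-cut zero    _     = inj₁ ((λ ()) , (λ ()) , (λ ()) , (λ ()))
    avoid-or-cut (suc k) paths with dropPathThrough paths
    ... | Q , Qpaths , avoid , disjoint with pathsFlow k Q Qpaths avoid disjoint
    ...   | F , flow , F⊆Q , Q⊆F , Fe with closure F n (_≡ᵇ r) (≡ᵇ-refl r) reachable-root (m≤m+n n _)
    ...     | inj₁ (ws , walk , unique) = inj₁ (reroute flow Fe walk unique)
    ...     | inj₂ (R , cut@(Rr , Rs , _)) =
      inj₂ (R , Rr , Rs , cut-bound paths (Q , Qpaths , avoid , disjoint) F⊆Q Q⊆F cut)

removeAt-index : ∀ {A : Set} (xs : List A) (e : Fin (length xs)) → Fin (length (removeAt xs e)) → Fin (length xs)
removeAt-index (x ∷ xs) zero    j       = suc j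
removeAt-index (x ∷ xs) (suc e) zero    = zero
removeAt-index (x ∷ xs) (suc e) (suc j) = suc (removeAt-index xs e j)

lookup-removeAt : ∀ {A : Set} (xs : List A) e j → List.lookup (removeAt xs e) j ≡ List.lookup xs (removeAt-index xs e j)
lookup-removeAt (x ∷ xs) zero    j       = refl
lookup-removeAt (x ∷ xs) (suc e) zero    = refl
lookup-removeAt (x ∷ xs) (suc e) (suc j) = lookup-removeAt xs e j

removeAt-index-onto : ∀ {A : Set} (xs : List A) e b → b ≢ e → ∃ λ j → removeAt-index xs e j ≡ b
removeAt-index-onto (x ∷ xs) zero    zero    b≢e = ⊥-elim (b≢e refl)
removeAt-index-onto (x ∷ xs) zero    (suc b) b≢e = b , refl
removeAt-index-onto (x ∷ xs) (suc e) zero    b≢e = zero , refl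
removeAt-index-onto (x ∷ xs) (suc e) (suc b) b≢e =
  let j , eq = removeAt-index-onto xs e b (λ b≡e → b≢e (cong suc b≡e)) in suc j , cong suc eq

module DeleteArc {n} (E : Edges n) (o : Orientation E) (e : Arc E) where

  E∖e : Edges n
  E∖e = removeAt E e

  o∖e : Orientation E∖e
  o∖e j = o (removeAt-index E e j)

  tl-removeAt : ∀ j → tl E∖e o∖e j ≡ tl E o (removeAt-index E e j)
  tl-removeAt j = cong (λ p → proj₁ (if o (removeAt-index E e j) then p else Product.swap p)) (lookup-removeAt E e j)

  hd-removeAt : ∀ j → hd E∖e o∖e j ≡ hd E o (removeAt-index E e j)
  hd-removeAt j = cong (λ p → proj₂ (if o (removeAt-index E e j) then p else Product.swap p)) (lookup-removeAt E e j)

  restrict-walk : ∀ {x y as} → Walk E o x y as → (∀ {b} → b ∈ₗ as → b ≢ e) →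
    Σ (List (Arc E∖e)) λ as′ → Walk E∖e o∖e x y as′ × map (removeAt-index E e) as′ ≡ as
  restrict-walk nil avoid = [] , nil , refl
  restrict-walk (step {a = a} p rest) avoid with removeAt-index-onto E e a (avoid (here refl))
                                              | restrict-walk rest (λ b∈ → avoid (there b∈))
  ... | j , refl | as′ , walk′ , refl =
    j ∷ as′ , step (trans (tl-removeAt j) p) (subst (λ z → Walk E∖e o∖e z _ as′) (sym (hd-removeAt j)) walk′) , refl

  restrict-path : ∀ {x y as} → IsPath E o x y as → (∀ {b} → b ∈ₗ as → b ≢ e) →
    Σ (List (Arc E∖e)) λ as′ → IsPath E∖e o∖e x y as′ × map (removeAt-index E e) as′ ≡ as
  restrict-path {x} (walk , unique) avoid with restrict-walk walk avoid
  ... | as′ , walk′ , refl = as′ , (walk′ , subst (λ vs → Unique (x ∷ vs)) (sym heads) unique) , refl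
    where
      heads : map (hd E∖e o∖e) as′ ≡ map (hd E o) (map (removeAt-index E e) as′)
      heads = trans (map-cong hd-removeAt as′) (map-∘ as′)

  restrict-arcDisjointPaths : ∀ {k r s} (Q : Fin k → List (Arc E)) → (∀ i → IsPath E o r s (Q i)) →
    (∀ i {b} → b ∈ₗ Q i → b ≢ e) → PairwiseDisjoint Q → ArcDisjointPaths E∖e o∖e k r s
  restrict-arcDisjointPaths Q paths avoid disjoint = Q′ , (λ i → proj₁ (proj₂ (restricted i))) , disjoint′
    where
      restricted = λ i → restrict-path (paths i) (avoid i)
      Q′ = λ i → proj₁ (restricted i)
      lift : ∀ {i a} → a ∈ₗ Q′ i → removeAt-index E e a ∈ₗ Q i
      lift {i} a∈ = subst (removeAt-index E e _ ∈ₗ_) (proj₂ (proj₂ (restricted i))) (∈-map⁺ (removeAt-index E e) a∈)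
      disjoint′ : ∀ i j a → i ≢ j → a ∈ₗ Q′ i → a ∈ₗ Q′ j → ⊥
      disjoint′ i j a i≢j a∈ a∈′ = disjoint i j _ i≢j (lift a∈) (lift a∈′)

does-∈? : ∀ {n} (x : Fin n) (U : Subset n) → does (x ∈? U) ≡ lookup U x
does-∈? zero    (true  ∷ U) = refl
does-∈? zero    (false ∷ U) = refl
does-∈? (suc x) (_ ∷ U)     = does-∈? x U

∉⇒lookup≡false : ∀ {n} {x : Fin n} {U : Subset n} → x ∉ U → lookup U x ≡ false
∉⇒lookup≡false x∉U = ¬-not λ Ux → x∉U (lookup⇒[]= _ _ Ux)

lookup≡false⇒∉ : ∀ {n} {x : Fin n} {U : Subset n} → lookup U x ≡ false → x ∉ U
lookup≡false⇒∉ Ux x∈U = true≢false (trans (sym ([]=⇒lookup x∈U)) Ux)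

length-filter-tabulate : ∀ {m} {A : Set} {P : A → Set} (P? : Decidable P) (f : Fin m → A) →
  length (filter P? (List.tabulate f)) ≡ count (λ i → does (P? (f i)))
length-filter-tabulate {zero}  P? f = refl
length-filter-tabulate {suc m} P? f with does (P? (f zero))
... | true  = cong suc (length-filter-tabulate P? (λ i → f (suc i)))
... | false = length-filter-tabulate P? (λ i → f (suc i))

outDeg≡δ⁺ : ∀ {n} (E : Edges n) (o : Orientation E) U → outDeg E o U ≡ Digraph.δ⁺ E o (lookup U)
outDeg≡δ⁺ E o U = trans (length-filter-tabulate (λ a → tl E o a ∈? U ×-dec ¬? (hd E o a ∈? U)) (λ a → a))
  (count-cong (λ b → cong₂ (λ p q → p ∧ not q) (does-∈? (tl E o b) U) (does-∈? (hd E o b) U)))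

∀⊎∃ : ∀ {n} {P Q : Fin n → Set} → (∀ i → P i ⊎ Q i) → (∀ i → P i) ⊎ ∃ Q
∀⊎∃ {zero}  h = inj₁ (λ ())
∀⊎∃ {suc n} {P} {Q} h with h zero | ∀⊎∃ {P = λ i → P (suc i)} {Q = λ i → Q (suc i)} (λ i → h (suc i))
... | inj₂ q | _            = inj₂ (zero , q)
... | inj₁ p | inj₂ (i , q) = inj₂ (suc i , q)
... | inj₁ p | inj₁ ps      = inj₁ (λ { zero → p ; (suc i) → ps i })

nonempty⇒∈ : ∀ {A : Set} (xs : List A) → xs ≢ [] → ∃ (_∈ₗ xs)
nonempty⇒∈ []       xs≢[] = ⊥-elim (xs≢[] refl)
nonempty⇒∈ (x ∷ xs) _     = x , here refl

module MinimalInstance {n k} (E : Edges n) (r : Fin n) (S : Subset n) (minimal : Minimal E k r S)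
  (o : Orientation E) (feasible : Feasible E o k r S) where

  open Digraph E o

  minimal⇒cut-leaving-by : ∀ b → ∃ λ s → s ∈ S × Σ (Fin n → Bool) λ R →
    R r ≡ true × R s ≡ false × leaves R b ≡ true × δ⁺ R ≤ k
  minimal⇒cut-leaving-by b with ∀⊎∃ avoid-or-cut-at
    where
      open DeleteArc E o b
      avoid-or-cut-at : ∀ s → (s ∈ S → ArcDisjointPaths E∖e o∖e k r s) ⊎ (s ∈ S × Σ (Fin n → Bool) λ R →
        R r ≡ true × R s ≡ false × leaves R b ≡ true × δ⁺ R ≤ k)
      avoid-or-cut-at s with s ∈? S
      ... | no  s∉S = inj₁ (λ s∈S → ⊥-elim (s∉S s∈S))
      ... | yes s∈S with Flow.avoid-or-cut r s b k (feasible s s∈S)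
      ...   | inj₁ (Q , paths , avoid , disjoint) = inj₁ (λ _ → restrict-arcDisjointPaths Q paths avoid disjoint)
      ...   | inj₂ cut = inj₂ (s∈S , cut)
  ... | inj₁ feasible∖b = ⊥-elim (proj₂ minimal b (DeleteArc.o∖e E o b , feasible∖b))
  ... | inj₂ cut = cut

  tight-cut : ∀ {s} → s ∈ S → ∀ R → R r ≡ true → R s ≡ false → δ⁺ R ≤ k → TightCut E o k r s (tabulate R)
  tight-cut s∈S R Rr Rs R≤k =
    (lookup⇒[]= _ _ (trans (lookup∘tabulate R _) Rr) , lookup≡false⇒∉ (trans (lookup∘tabulate R _) Rs)) ,
    trans (outDeg≡δ⁺ E o (tabulate R))
      (trans (δ⁺-cong (lookup∘tabulate R)) (≤-antisym R≤k (arcDisjointPaths⇒≤δ⁺ (feasible _ s∈S) Rr Rs)))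

  module _ (S′ : Subset n) (S′⊆S : S′ ⊆ S) {s₀} (s₀∈S′ : s₀ ∈ S′) (X : Subset n)
    (X-tight : ∀ s → s ∈ S′ → TightCut E o k r s X) where

    InX : (Fin n → Bool) → Set
    InX A = ∀ x → A x ≡ true → lookup X x ≡ true

    TightInX : (Fin n → Bool) → Set
    TightInX A = A r ≡ true × InX A × δ⁺ A ≤ k

    X∌ : ∀ {s} → s ∈ S′ → lookup X s ≡ false
    X∌ s∈S′ = ∉⇒lookup≡false (proj₂ (proj₁ (X-tight _ s∈S′)))

    k≤δ⁺-inX : ∀ A → A r ≡ true → InX A → k ≤ δ⁺ A
    k≤δ⁺-inX A Ar A⊆X = arcDisjointPaths⇒≤δ⁺ (feasible s₀ (S′⊆S s₀∈S′)) Ar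
      (¬-not λ As₀ → true≢false (trans (sym (A⊆X s₀ As₀)) (X∌ s₀∈S′)))

    tightInX-uncrossed : ∀ {A B} → TightInX A → TightInX B → ∀ b → crossing A B b ≢ true
    tightInX-uncrossed {A} {B} (Ar , A⊆X , A≤k) (Br , B⊆X , B≤k) = δ⁺-uncrossed A B A≤k B≤k
      (k≤δ⁺-inX _ (cong₂ _∧_ Ar Br) (λ x ABx → A⊆X x (proj₁ (∧≡true⇒ ABx))))
      (k≤δ⁺-inX _ (∨≡true-introˡ (B r) Ar) (λ x ABx → [ A⊆X x , B⊆X x ]′ (∨≡true⇒ ABx)))

    tight∩X : ∀ {s} → s ∈ S′ → ∀ R → R r ≡ true → R s ≡ false → δ⁺ R ≤ k → TightInX (λ x → R x ∧ lookup X x)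
    tight∩X {s} s∈S′ R Rr Rs R≤k =
      cong₂ _∧_ Rr ([]=⇒lookup (proj₁ (proj₁ (X-tight s s∈S′)))) ,
      (λ x RXx → proj₂ (∧≡true⇒ {R x} RXx)) ,
      δ⁺-∧-≤ R (lookup X) R≤k X≤k
        (arcDisjointPaths⇒≤δ⁺ (feasible s (S′⊆S s∈S′)) (∨≡true-introˡ _ Rr) (cong₂ _∨_ Rs (X∌ s∈S′)))
      where
        X≤k : δ⁺ (lookup X) ≤ k
        X≤k = ≤-reflexive (trans (sym (outDeg≡δ⁺ E o X)) (proj₂ (X-tight s s∈S′)))

    module _ (C : DirCycle E o) (C⊆X : All (_∈ X) (cycleVerts C))
      (essential⇒S′ : ∀ s → s ∈ S → Essential E o k r s C → s ∈ S′) where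

      open DirCycle C

      cycleArc-leaves-tightInX : ∀ {b} → b ∈ₗ arcs → Σ (Fin n → Bool) λ A → TightInX A × leaves A b ≡ true
      cycleArc-leaves-tightInX {b} b∈ with minimal⇒cut-leaving-by b
      ... | s , s∈S , R , Rr , Rs , lb , R≤k =
        (λ x → R x ∧ lookup X x) , tight∩X s∈S′ R Rr Rs R≤k , leaves-intro {λ x → R x ∧ lookup X x} Rt∧Xt Rh∧Xh
        where
          Rt : R (tail b) ≡ true
          Rt = proj₁ (leaves-elim {R} lb)
          Rh : R (head b) ≡ false
          Rh = proj₂ (leaves-elim {R} lb)
          U = tabulate R
          U≗R : ∀ x → lookup U x ≡ R x
          U≗R = lookup∘tabulate R
          U-crosses-C : ProperlyIntersects U C
          U-crosses-C = (tail b , ∈-map⁺ tail b∈ , lookup⇒[]= _ _ (trans (U≗R (tail b)) Rt)) ,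
                        (head b , closedWalk-head∈ closed b∈ , lookup≡false⇒∉ (trans (U≗R (head b)) Rh))
          s∈S′ : s ∈ S′
          s∈S′ = essential⇒S′ s s∈S (U , tight-cut s∈S R Rr Rs R≤k , U-crosses-C)
          Rt∧Xt : R (tail b) ∧ lookup X (tail b) ≡ true
          Rt∧Xt = cong₂ _∧_ Rt ([]=⇒lookup (All.lookup C⊆X (∈-map⁺ tail b∈)))
          Rh∧Xh : R (head b) ∧ lookup X (head b) ≡ false
          Rh∧Xh = cong (_∧ lookup X (head b)) Rh

      no-cycle : ⊥
      no-cycle = closedWalk-noEntry⇒¬leaves {A} closed noEntry b∈ A-leaves
        where
          b∈ = proj₂ (nonempty⇒∈ arcs nonemp)
          A = proj₁ (cycleArc-leaves-tightInX b∈)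
          A-tight = proj₁ (proj₂ (cycleArc-leaves-tightInX b∈))
          A-leaves = proj₂ (proj₂ (cycleArc-leaves-tightInX b∈))
          noEntry : NoEntry A arcs
          noEntry b′ b′∈ Ah = ¬-not λ At →
            let A′ , A′-tight , A′-leaves = cycleArc-leaves-tightInX b′∈ in
            tightInX-uncrossed A′-tight A-tight b′ (crossing-intro {A′} {A} A′-leaves At Ah)

lemma2p12 : (n k t : ℕ) (E : Edges n) → Loopless E → (r : Fin n) (S : Subset n) →
    r ∉ S → ∣ S ∣ ≡ t → ThreeRegular E k r S → Minimal E k r S →
    (o : Orientation E) → Feasible E o k r S →
    (S' : Subset n) → S' ⊆ S → Nonempty S' →
    (X : Subset n) → (∀ s → s ∈ S' → TightCut E o k r s X) →
    ¬ (Σ (DirCycle E o) λ C →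
         All (λ v → v ∈ X) (cycleVerts C) ×
         (∀ s → s ∈ S → Essential E o k r s C → s ∈ S'))
lemma2p12 n k t E _ r S _ _ _ minimal o feasible S′ S′⊆S (_ , s₀∈S′) X X-tight (C , C⊆X , essential⇒S′) =
  MinimalInstance.no-cycle E r S minimal o feasible S′ S′⊆S s₀∈S′ X X-tight C C⊆X essential⇒S′
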